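{- If $H$ is a nontrivial hypergraph, then \[ \frac{1}{\alpha(\overline{H})} + \frac{1}{\beta(H^*)} = 1. \]
   Context: A hypergraph $H=(V,E)$ has a finite vertex set and a finite multiset of edges (subsets of $V$). $H$ is nontrivial if it has no empty edge and no vertex belonging to all edges. The complement is $\overline{H} = (V,\{V\setminus e : e\in E\})$; the dual is $H^* = (E, \{\{e : e\ni v\}: v\in V\})$. For a hypergraph $H=(V,E)$: for $S\subseteq V$, $\rho_H(S) = \max\{|S\cap e|: e\in E\}$, and $\alpha(H) = \max_{S\subseteq V,\ \rho_H(S)>0}|S|/\rho_H(S)$; for $Z\subseteq E$, $\tilde\rho_H(Z) = \min\{|\{e\in Z: v\in e\}| : v\in V\}$, and $\beta(H) = \min_{Z\subseteq E,\ \tilde\rho_H(Z)>0}|Z|/\tilde\rho_H(Z)$. -}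

module Defs where

open import Data.Nat as ℕ using (ℕ; zero; suc; _⊔_; _⊓_)
open import Data.Fin using (Fin; zero; suc)
open import Data.Fin.Subset using (Subset; _∈_; _∉_; _∩_; ∁; ∣_∣; Nonempty)
open import Data.Fin.Subset.Properties using (_∈?_)
open import Data.Vec using (tabulate)
open import Data.Integer using (+_)
open import Data.Rational as ℚ using (ℚ; 0ℚ; 1/_; _≤_)
open import Data.Product using (Σ; ∃; _×_)
open import Relation.Nullary using (¬_; does; yes; no)
open import Relation.Binary.PropositionalEquality using (_≡_)
open import Function using (_∘_)

-- A hypergraph with vertex set Fin n and a multiset of m edges,
-- given as an indexed family (edge i : Subset n) for i : Fin m.
record Hypergraph : Set where
  constructor hypergraph
  field
    n : ℕ
    m : ℕ
    edge : Fin m → Subset n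
open Hypergraph public

Nontrivial : Hypergraph → Set
Nontrivial H = (∀ i → Nonempty (edge H i)) × (∀ v → ¬ (∀ i → v ∈ edge H i))

complement : Hypergraph → Hypergraph
complement (hypergraph n m e) = hypergraph n m (λ i → ∁ (e i))

incident : (H : Hypergraph) → Fin (n H) → Subset (m H)
incident H v = tabulate (λ i → does (v ∈? edge H i))

dual : Hypergraph → Hypergraph
dual H = hypergraph (m H) (n H) (incident H)

maxF : (k : ℕ) → (Fin k → ℕ) → ℕ
maxF zero f = 0
maxF (suc k) f = f zero ⊔ maxF k (f ∘ suc)

-- minimum of finitely many naturals (0 for the empty family, never used
-- for nontrivial hypergraphs)
minF : (k : ℕ) → (Fin k → ℕ) → ℕ
minF zero f = 0
minF (suc zero) f = f zero
minF (suc (suc k)) f = f zero ⊓ minF (suc k) (f ∘ suc)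

ρ : (H : Hypergraph) → Subset (n H) → ℕ
ρ H S = maxF (m H) (λ i → ∣ S ∩ edge H i ∣)

ρ̃ : (H : Hypergraph) → Subset (m H) → ℕ
ρ̃ H Z = minF (n H) (λ v → ∣ Z ∩ incident H v ∣)

-- the rational p / q (only used with q > 0; set to 0 when q = 0)
frac : ℕ → ℕ → ℚ
frac p zero = 0ℚ
frac p (suc q) = (+ p) ℚ./ suc q

IsAlpha : (H : Hypergraph) → ℚ → Set
IsAlpha H a =
  (∃ λ S → (0 ℕ.< ρ H S) × (a ≡ frac ∣ S ∣ (ρ H S)))
  × (∀ S → 0 ℕ.< ρ H S → frac ∣ S ∣ (ρ H S) ≤ a)

IsBeta : (H : Hypergraph) → ℚ → Set
IsBeta H b =
  (∃ λ Z → (0 ℕ.< ρ̃ H Z) × (b ≡ frac ∣ Z ∣ (ρ̃ H Z)))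
  × (∀ Z → 0 ℕ.< ρ̃ H Z → b ≤ frac ∣ Z ∣ (ρ̃ H Z))

-- total reciprocal (1/0 := 0; only applied to positive values here)
inv : ℚ → ℚ
inv q with q ℚ.≟ 0ℚ
... | yes _ = 0ℚ
... | no q≢0 = 1/_ q {{ℚ.≢-nonZero q≢0}}

module Submission where

-- Write t(X) = min over edges e of |X ∩ e|. Then ρ of the complement is |X| − t(X) and ρ̃ of
-- the dual is t(X), so 1/α = 1 − t(S)/|S| for a maximiser S and 1/β = t(Z)/|Z| for a
-- minimiser Z. Since no vertex lies in all edges, t(Z) < |Z|, so Z competes for α; this
-- forces t(S)/|S| ≥ t(Z)/|Z| > 0, so S in turn competes for β, and the two ratios coincide.

open import Defs
open import Data.Nat as ℕ using (ℕ; zero; suc; _⊔_; _⊓_; _∸_; _*_; _≤_; _<_; s≤s; >-nonZero; >-nonZero⁻¹)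
open import Data.Nat.Properties
open import Data.Integer as ℤ using (+_)
import Data.Integer.Properties as ℤ
open import Data.Rational as ℚ using (ℚ; 0ℚ; 1ℚ; _+_; 1/_)
import Data.Rational.Properties as ℚ
open import Data.Rational.Unnormalised as ℚᵘ using (mkℚᵘ; *≡*; *≤*)
import Data.Rational.Unnormalised.Properties as ℚᵘ
open import Data.Bool using (Bool; true; false)
open import Data.Fin using (Fin; zero; suc)
open import Data.Fin.Properties using (¬∀⟶∃¬)
open import Data.Fin.Subset using (Subset; _∈_; _∉_; _∩_; ∁; ∣_∣; Nonempty; inside; outside)
open import Data.Fin.Subset.Properties using (_∈?_; ∣p∩q∣≤∣p∣)
open import Data.Vec using (_∷_; []; here; there; tabulate)
open import Data.Vec.Properties using (tabulate-cong)
open import Data.Product using (_,_)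
open import Data.Empty using (⊥-elim)
open import Relation.Nullary using (¬_; does; yes; no)
open import Relation.Binary.PropositionalEquality
open import Function using (_∘_)

∣p∩∁q∣+∣p∩q∣≡∣p∣ : ∀ {k} (p q : Subset k) → ∣ p ∩ ∁ q ∣ ℕ.+ ∣ p ∩ q ∣ ≡ ∣ p ∣
∣p∩∁q∣+∣p∩q∣≡∣p∣ [] [] = refl
∣p∩∁q∣+∣p∩q∣≡∣p∣ (outside ∷ p) (_ ∷ q) = ∣p∩∁q∣+∣p∩q∣≡∣p∣ p q
∣p∩∁q∣+∣p∩q∣≡∣p∣ (inside ∷ p) (outside ∷ q) = cong suc (∣p∩∁q∣+∣p∩q∣≡∣p∣ p q)
∣p∩∁q∣+∣p∩q∣≡∣p∣ (inside ∷ p) (inside ∷ q) =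
  trans (+-suc _ _) (cong suc (∣p∩∁q∣+∣p∩q∣≡∣p∣ p q))

∣p∩∁q∣≡∣p∣∸∣p∩q∣ : ∀ {k} (p q : Subset k) → ∣ p ∩ ∁ q ∣ ≡ ∣ p ∣ ∸ ∣ p ∩ q ∣
∣p∩∁q∣≡∣p∣∸∣p∩q∣ p q =
  trans (sym (m+n∸n≡m _ ∣ p ∩ q ∣)) (cong (_∸ ∣ p ∩ q ∣) (∣p∩∁q∣+∣p∩q∣≡∣p∣ p q))

x∈p∧x∉q⇒∣p∩q∣<∣p∣ : ∀ {k} (p q : Subset k) {x} → x ∈ p → x ∉ q → ∣ p ∩ q ∣ < ∣ p ∣
x∈p∧x∉q⇒∣p∩q∣<∣p∣ (inside ∷ p) (outside ∷ q) here x∉q = s≤s (∣p∩q∣≤∣p∣ p q)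
x∈p∧x∉q⇒∣p∩q∣<∣p∣ (inside ∷ p) (inside ∷ q) here x∉q = ⊥-elim (x∉q here)
x∈p∧x∉q⇒∣p∩q∣<∣p∣ (outside ∷ p) (_ ∷ q) (there x∈p) x∉q =
  x∈p∧x∉q⇒∣p∩q∣<∣p∣ p q x∈p (x∉q ∘ there)
x∈p∧x∉q⇒∣p∩q∣<∣p∣ (inside ∷ p) (outside ∷ q) (there x∈p) x∉q =
  m≤n⇒m≤1+n (x∈p∧x∉q⇒∣p∩q∣<∣p∣ p q x∈p (x∉q ∘ there))
x∈p∧x∉q⇒∣p∩q∣<∣p∣ (inside ∷ p) (inside ∷ q) (there x∈p) x∉q =
  s≤s (x∈p∧x∉q⇒∣p∩q∣<∣p∣ p q x∈p (x∉q ∘ there))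

∣p∣>0⇒Nonempty : ∀ {k} (p : Subset k) → 0 < ∣ p ∣ → Nonempty p
∣p∣>0⇒Nonempty (inside ∷ p) _ = zero , here
∣p∣>0⇒Nonempty (outside ∷ p) ∣p∣>0 with ∣p∣>0⇒Nonempty p ∣p∣>0
... | x , x∈p = suc x , there x∈p

does-∈?-tabulate : ∀ {k} (f : Fin k → Bool) i → does (i ∈? tabulate f) ≡ f i
does-∈?-tabulate f zero with f zero
... | true = refl
... | false = refl
does-∈?-tabulate f (suc i) = does-∈?-tabulate (f ∘ suc) i

tabulate-does-∈? : ∀ {k} (p : Subset k) → tabulate (λ x → does (x ∈? p)) ≡ p
tabulate-does-∈? [] = refl
tabulate-does-∈? (inside ∷ p) = cong (inside ∷_) (tabulate-does-∈? p)
tabulate-does-∈? (outside ∷ p) = cong (outside ∷_) (tabulate-does-∈? p)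

maxF-cong : ∀ k {f g : Fin k → ℕ} → (∀ i → f i ≡ g i) → maxF k f ≡ maxF k g
maxF-cong zero f≗g = refl
maxF-cong (suc k) f≗g = cong₂ _⊔_ (f≗g zero) (maxF-cong k (f≗g ∘ suc))

minF-cong : ∀ k {f g : Fin k → ℕ} → (∀ i → f i ≡ g i) → minF k f ≡ minF k g
minF-cong zero f≗g = refl
minF-cong (suc zero) f≗g = f≗g zero
minF-cong (suc (suc k)) f≗g = cong₂ _⊓_ (f≗g zero) (minF-cong (suc k) (f≗g ∘ suc))

minF≤ : ∀ k (f : Fin k → ℕ) i → minF k f ≤ f i
minF≤ (suc zero) f zero = ≤-refl
minF≤ (suc (suc k)) f zero = m⊓n≤m _ _
minF≤ (suc (suc k)) f (suc i) = ≤-trans (m⊓n≤n _ _) (minF≤ (suc k) (f ∘ suc) i)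

maxF-∸ : ∀ k s (f : Fin (suc k) → ℕ) → maxF (suc k) (λ i → s ∸ f i) ≡ s ∸ minF (suc k) f
maxF-∸ zero s f = ⊔-identityʳ _
maxF-∸ (suc k) s f = begin
  (s ∸ f zero) ⊔ maxF (suc k) (λ i → s ∸ f (suc i)) ≡⟨ cong ((s ∸ f zero) ⊔_) (maxF-∸ k s (f ∘ suc)) ⟩
  (s ∸ f zero) ⊔ (s ∸ minF (suc k) (f ∘ suc))      ≡⟨ ∸-distribˡ-⊓-⊔ s (f zero) _ ⟨
  s ∸ minF (suc (suc k)) f                         ∎
  where open ≡-Reasoning

incident-dual : (H : Hypergraph) (i : Fin (m H)) → incident (dual H) i ≡ edge H i
incident-dual H i = trans
  (tabulate-cong (λ v → does-∈?-tabulate (λ j → does (v ∈? edge H j)) i))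
  (tabulate-does-∈? (edge H i))

-- For a hypergraph without edges this is the junk value 0 of minF.
minMeet : (H : Hypergraph) → Subset (n H) → ℕ
minMeet H X = minF (m H) (λ i → ∣ X ∩ edge H i ∣)

ρ̃-dual : (H : Hypergraph) (X : Subset (n H)) → ρ̃ (dual H) X ≡ minMeet H X
ρ̃-dual H X = minF-cong (m H) (λ i → cong (λ e → ∣ X ∩ e ∣) (incident-dual H i))

ρ-complement : ∀ {n k} (e : Fin (suc k) → Subset n) (X : Subset n)
             → ρ (complement (hypergraph n (suc k) e)) X ≡ ∣ X ∣ ∸ minMeet (hypergraph n (suc k) e) X
ρ-complement {k = k} e X = trans
  (maxF-cong (suc k) (λ i → ∣p∩∁q∣≡∣p∣∸∣p∩q∣ X (e i)))
  (maxF-∸ k ∣ X ∣ _)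

minMeet≤∣X∣ : ∀ {n k} (e : Fin (suc k) → Subset n) (X : Subset n)
            → minMeet (hypergraph n (suc k) e) X ≤ ∣ X ∣
minMeet≤∣X∣ {k = k} e X = ≤-trans (minF≤ (suc k) _ zero) (∣p∩q∣≤∣p∣ X (e zero))

minMeet<∣X∣ : (H : Hypergraph) → (∀ v → ¬ (∀ i → v ∈ edge H i))
            → (X : Subset (n H)) → 0 < ∣ X ∣ → minMeet H X < ∣ X ∣
minMeet<∣X∣ H noVertexInAll X ∣X∣>0 with ∣p∣>0⇒Nonempty X ∣X∣>0
... | v , v∈X with ¬∀⟶∃¬ (m H) _ (λ i → v ∈? edge H i) (noVertexInAll v)
...   | i , v∉e = ≤-<-trans (minF≤ (m H) _ i) (x∈p∧x∉q⇒∣p∩q∣<∣p∣ X (edge H i) v∈X v∉e)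

toℚᵘ-frac : ∀ p q → ℚ.toℚᵘ (frac p (suc q)) ℚᵘ.≃ mkℚᵘ (+ p) q
toℚᵘ-frac p q = ℚ.toℚᵘ-fromℚᵘ (mkℚᵘ (+ p) q)

frac-≤⇒*-≤ : ∀ {p q r u} → 0 < q → 0 < u → frac p q ℚ.≤ frac r u → p * u ≤ r * q
frac-≤⇒*-≤ {p} {suc q} {r} {suc u} _ _ le
  with ℚᵘ.≤-respʳ-≃ (toℚᵘ-frac r u) (ℚᵘ.≤-respˡ-≃ (toℚᵘ-frac p q) (ℚ.toℚᵘ-mono-≤ le))
... | *≤* pu≤rq = ℤ.drop‿+≤+ (subst₂ ℤ._≤_ (ℤ.+◃n≡+n (p * suc u)) (ℤ.+◃n≡+n (r * suc q)) pu≤rq)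

inv-unique : ∀ x y → x ℚ.* y ≡ 1ℚ → inv x ≡ y
inv-unique x y xy≡1 with x ℚ.≟ 0ℚ
... | yes refl with () ← trans (sym (ℚ.*-zeroˡ y)) xy≡1
... | no x≢0 = begin
  1/ x               ≡⟨ ℚ.*-identityʳ _ ⟨
  1/ x ℚ.* 1ℚ        ≡⟨ cong (1/ x ℚ.*_) xy≡1 ⟨
  1/ x ℚ.* (x ℚ.* y) ≡⟨ ℚ.*-assoc (1/ x) x y ⟨
  1/ x ℚ.* x ℚ.* y   ≡⟨ cong (ℚ._* y) (ℚ.*-inverseˡ x) ⟩
  1ℚ ℚ.* y           ≡⟨ ℚ.*-identityˡ y ⟩
  y                  ∎
  where
  open ≡-Reasoning
  instance
    x≢0′ : ℚ.NonZero x
    x≢0′ = ℚ.≢-nonZero x≢0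

inv-frac : ∀ {p q} → 0 < p → 0 < q → inv (frac p q) ≡ frac q p
inv-frac {suc p} {suc q} _ _ = inv-unique x y (ℚ.toℚᵘ-injective (begin
  ℚ.toℚᵘ (x ℚ.* y)                        ≈⟨ ℚ.toℚᵘ-homo-* x y ⟩
  ℚ.toℚᵘ x ℚᵘ.* ℚ.toℚᵘ y                  ≈⟨ ℚᵘ.*-cong (toℚᵘ-frac (suc p) q) (toℚᵘ-frac (suc q) p) ⟩
  mkℚᵘ (+ suc p) q ℚᵘ.* mkℚᵘ (+ suc q) p ≈⟨ *≡* pq≡qp ⟩
  ℚᵘ.1ℚᵘ                                  ∎))
  where
  open ℚᵘ.≃-Reasoning
  x y : ℚ
  x = frac (suc p) (suc q)
  y = frac (suc q) (suc p)
  pq≡qp : + suc p ℤ.* + suc q ℤ.* + 1 ≡ + 1 ℤ.* + (suc q * suc p)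
  pq≡qp = trans (ℤ.*-identityʳ _) (trans (cong +_ (*-comm (suc p) (suc q))) (sym (ℤ.*-identityˡ _)))

frac+frac≡1 : ∀ {p q r u} → 0 < q → 0 < u → p * u ℕ.+ r * q ≡ q * u → frac p q + frac r u ≡ 1ℚ
frac+frac≡1 {p} {suc q} {r} {suc u} _ _ eq = ℚ.toℚᵘ-injective (begin
  ℚ.toℚᵘ (frac p (suc q) + frac r (suc u))
    ≈⟨ ℚ.toℚᵘ-homo-+ (frac p (suc q)) (frac r (suc u)) ⟩
  ℚ.toℚᵘ (frac p (suc q)) ℚᵘ.+ ℚ.toℚᵘ (frac r (suc u))
    ≈⟨ ℚᵘ.+-cong (toℚᵘ-frac p q) (toℚᵘ-frac r u) ⟩
  mkℚᵘ (+ p) q ℚᵘ.+ mkℚᵘ (+ r) u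
    ≈⟨ *≡* (trans (ℤ.*-identityʳ _) (trans numerator (sym (ℤ.*-identityˡ _)))) ⟩
  ℚᵘ.1ℚᵘ ∎)
  where
  open ℚᵘ.≃-Reasoning
  numerator : + p ℤ.* + suc u ℤ.+ + r ℤ.* + suc q ≡ + (suc q * suc u)
  numerator = trans (cong₂ ℤ._+_ (ℤ.+◃n≡+n (p * suc u)) (ℤ.+◃n≡+n (r * suc q))) (cong +_ eq)

*-∸-cross : ∀ {s t z u} → u ≤ z → z * (s ∸ t) ≤ s * (z ∸ u) → s * u ≤ z * t
*-∸-cross {s} {t} {z} {u} u≤z le = ∸-cancelʳ-≤ (*-monoʳ-≤ s u≤z) (subst₂ _≤_ zs∸zt zs∸su le)
  where
  zs∸zt : z * (s ∸ t) ≡ s * z ∸ z * t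
  zs∸zt = trans (*-distribˡ-∸ z s t) (cong (_∸ z * t) (*-comm z s))
  zs∸su : s * (z ∸ u) ≡ s * z ∸ s * u
  zs∸su = *-distribˡ-∸ s z u

-- s = |S|, t = t(S) for a maximiser S of α, and z = |Z|, u = t(Z) for a minimiser Z of β.
reciprocals-sum-to-one : ∀ {s t z u} → t ≤ s → u < z → 0 < s ∸ t → 0 < u
  → frac z (z ∸ u) ℚ.≤ frac s (s ∸ t)
  → (0 < t → frac z u ℚ.≤ frac s t)
  → inv (frac s (s ∸ t)) + inv (frac z u) ≡ 1ℚ
reciprocals-sum-to-one {s} {t} {z} {u} t≤s u<z s∸t>0 u>0 α-max β-min = begin
  inv (frac s (s ∸ t)) + inv (frac z u) ≡⟨ cong₂ _+_ (inv-frac s>0 s∸t>0) (inv-frac z>0 u>0) ⟩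
  frac (s ∸ t) s + frac u z             ≡⟨ frac+frac≡1 s>0 z>0 cross ⟩
  1ℚ                                    ∎
  where
  open ≡-Reasoning
  s>0 : 0 < s
  s>0 = <-≤-trans s∸t>0 (m∸n≤m s t)
  z>0 : 0 < z
  z>0 = <-trans u>0 u<z
  su≤zt : s * u ≤ z * t
  su≤zt = *-∸-cross (<⇒≤ u<z) (frac-≤⇒*-≤ (m<n⇒0<n∸m u<z) s∸t>0 α-max)
  t>0 : 0 < t
  t>0 = >-nonZero⁻¹ t {{m*n≢0⇒n≢0 z {{>-nonZero zt>0}}}}
    where
    instance
      _ = >-nonZero s>0
      _ = >-nonZero u>0
    zt>0 : 0 < z * t
    zt>0 = <-≤-trans (>-nonZero⁻¹ (s * u) {{m*n≢0 s u}}) su≤zt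
  zt≡su : z * t ≡ s * u
  zt≡su = ≤-antisym (frac-≤⇒*-≤ u>0 t>0 (β-min t>0)) su≤zt
  us≡tz : u * s ≡ t * z
  us≡tz = trans (*-comm u s) (trans (sym zt≡su) (*-comm z t))
  cross : (s ∸ t) * z ℕ.+ u * s ≡ s * z
  cross = begin
    (s ∸ t) * z ℕ.+ u * s     ≡⟨ cong₂ ℕ._+_ (*-distribʳ-∸ z s t) us≡tz ⟩
    (s * z ∸ t * z) ℕ.+ t * z ≡⟨ m∸n+n≡m (*-monoˡ-≤ z t≤s) ⟩
    s * z                     ∎

lemma2 : (H : Hypergraph) → Nontrivial H → (a b : ℚ)
    → IsAlpha (complement H) a → IsBeta (dual H) b
    → inv a + inv b ≡ 1ℚ
lemma2 (hypergraph n zero e) _ _ _ ((_ , () , _) , _) _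
lemma2 H@(hypergraph n (suc k) e) (_ , noVertexInAll) _ _
       ((S , ρS>0 , refl) , α-max) ((Z , ρ̃Z>0 , refl) , β-min) =
  subst₂ (λ x y → inv (frac ∣ S ∣ x) + inv (frac ∣ Z ∣ y) ≡ 1ℚ) (sym (ρᶜ S)) (sym (ρ̃* Z))
    (reciprocals-sum-to-one (minMeet≤∣X∣ e S) t<∣Z∣ (subst (0 <_) (ρᶜ S) ρS>0) t>0 α-max-at-Z β-min-at-S)
  where
  ρᶜ : ∀ X → ρ (complement H) X ≡ ∣ X ∣ ∸ minMeet H X
  ρᶜ = ρ-complement e
  ρ̃* : ∀ X → ρ̃ (dual H) X ≡ minMeet H X
  ρ̃* = ρ̃-dual H
  t>0 : 0 < minMeet H Z
  t>0 = subst (0 <_) (ρ̃* Z) ρ̃Z>0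
  t<∣Z∣ : minMeet H Z < ∣ Z ∣
  t<∣Z∣ = minMeet<∣X∣ H noVertexInAll Z (<-≤-trans t>0 (minMeet≤∣X∣ e Z))
  α-max-at-Z : frac (∣ Z ∣) (∣ Z ∣ ∸ minMeet H Z) ℚ.≤ frac (∣ S ∣) (∣ S ∣ ∸ minMeet H S)
  α-max-at-Z = subst₂ (λ x y → frac (∣ Z ∣) x ℚ.≤ frac (∣ S ∣) y) (ρᶜ Z) (ρᶜ S)
    (α-max Z (subst (0 <_) (sym (ρᶜ Z)) (m<n⇒0<n∸m t<∣Z∣)))
  β-min-at-S : 0 < minMeet H S → frac (∣ Z ∣) (minMeet H Z) ℚ.≤ frac (∣ S ∣) (minMeet H S)
  β-min-at-S tS>0 = subst₂ (λ x y → frac (∣ Z ∣) x ℚ.≤ frac (∣ S ∣) y) (ρ̃* Z) (ρ̃* S)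
    (β-min S (subst (0 <_) (sym (ρ̃* S)) tS>0))
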